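{- In the setting below, for every $b\in K$, $$h(b)=\{w\in\overline\Sigma^+\mid w^\bullet\preceq b\text{ in }\mathcal K\}\cup\{x\in\Sigma^+\mid |x|_{\underline\Sigma}>0\}.$$
   Context: Let $\mathcal K=(K;\preceq,\cdot,\backslash,/,\wedge,\vee,\top,\bot,{}^+)$ be an $\omega$PAL: $(K;\preceq,\wedge,\vee,\top,\bot)$ a bounded lattice, $\cdot$ associative, $b\preceq a\backslash c\iff a\cdot b\preceq c\iff a\preceq c/b$, and $a^+=\sup\{a^n\mid n\ge1\}$. Let $\overline\Sigma=\{\overline a\mid a\in K\}$ and $\underline\Sigma=\{\underline b\mid b\in K\}$ be two disjoint copies of $K$ as alphabets and $\Sigma=\overline\Sigma\cup\underline\Sigma$. For $w=\overline{a_1}\cdots\overline{a_n}\in\overline\Sigma^+$ let $w^\bullet=a_1\cdot\ldots\cdot a_n\in K$. For $x\in\Sigma^*$, $|x|_{\underline\Sigma}$ is the number of letters of $x$ from $\underline\Sigma$. Let $L=\{w\underline b\mid w\in\overline\Sigma^+, b\in K, w^\bullet\preceq b\}\cup\{x\in\Sigma^+\mid |x|_{\underline\Sigma}\ge2\}$, and define $h(b)=\{x\in\Sigma^+\mid x\underline b\in L\}$ for $b\in K$. -}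

module Defs where

open import Level using (Level; _⊔_) renaming (suc to lsuc)
open import Data.Nat using (ℕ; zero; suc; _≥_; _>_)
open import Data.List using (List; []; _∷_; _++_; [_]; map)
open import Data.List.NonEmpty using (List⁺; toList; foldr₁)
open import Data.Product using (Σ; ∃; _×_; _,_)
open import Data.Sum using (_⊎_; inj₁; inj₂)
open import Relation.Binary.Core using (Rel)
open import Relation.Binary.Structures using (IsPartialOrder)
open import Relation.Binary.Lattice.Structures using (IsBoundedLattice)
open import Relation.Binary.PropositionalEquality using (_≡_)
open import Algebra.Core using (Op₂)
open import Algebra.Definitions using (Associative)

-- positive powers: pow _·_ a n = a^(n+1)
pow : ∀ {c} {A : Set c} → Op₂ A → A → ℕ → A
pow _·_ a zero    = a
pow _·_ a (suc n) = a · pow _·_ a n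

record ωPAL (c ℓ : Level) : Set (lsuc (c ⊔ ℓ)) where
  infix  4 _⪯_
  infixl 7 _·_
  field
    K    : Set c
    _⪯_  : Rel K ℓ
    _·_  : Op₂ K
    _＼_ : Op₂ K
    _／_ : Op₂ K
    _∧_  : Op₂ K
    _∨_  : Op₂ K
    ⊤    : K
    ⊥    : K
    _⁺   : K → K
    isBoundedLattice : IsBoundedLattice _≡_ _⪯_ _∨_ _∧_ ⊤ ⊥
    ·-assoc : Associative _≡_ _·_
    resid-l : ∀ a b c → (b ⪯ a ＼ c → a · b ⪯ c) × (a · b ⪯ c → b ⪯ a ＼ c)
    resid-r : ∀ a b c → (a · b ⪯ c → a ⪯ c ／ b) × (a ⪯ c ／ b → a · b ⪯ c)

    ⁺-upper : ∀ a n → pow _·_ a n ⪯ a ⁺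
    ⁺-least : ∀ a u → (∀ n → pow _·_ a n ⪯ u) → a ⁺ ⪯ u

module Words {c ℓ : Level} (𝒦 : ωPAL c ℓ) where
  open ωPAL 𝒦

  -- Σ = overline-copy ⊎ underline-copy of K
  data Letter : Set c where
    over  : K → Letter
    under : K → Letter

  Word : Set c
  Word = List Letter

  NonEmpty : Word → Set
  NonEmpty []      = Data.Empty.⊥
    where import Data.Empty
  NonEmpty (_ ∷ _) = Data.Unit.⊤
    where import Data.Unit

  countUnder : Word → ℕ
  countUnder []            = zero
  countUnder (over _  ∷ x) = countUnder x
  countUnder (under _ ∷ x) = suc (countUnder x)

  overWord : List⁺ K → Word
  overWord w = map over (toList w)

  bullet : List⁺ K → K
  bullet w = foldr₁ _·_ w

  L : Word → Set (c ⊔ ℓ)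
  L x = (Σ (List⁺ K) λ w → Σ K λ b → x ≡ overWord w ++ [ under b ] × bullet w ⪯ b)
      ⊎ (NonEmpty x × countUnder x ≥ 2)

  h : K → Word → Set (c ⊔ ℓ)
  h b x = NonEmpty x × L (x ++ [ under b ])

  RHS : K → Word → Set (c ⊔ ℓ)
  RHS b x = (Σ (List⁺ K) λ w → x ≡ overWord w × bullet w ⪯ b)
          ⊎ (NonEmpty x × countUnder x > 0)

{-# OPTIONS --safe #-}
module Submission where

open import Defs
open import Level using (Level)
open import Function.Bundles using (_⇔_; mk⇔)
open import Data.Nat using (suc; _+_; _≥_; s≤s; s≤s⁻¹)
open import Data.Nat.Properties using (+-comm)
open import Data.List using ([]; _∷_; _++_; [_])
open import Data.List.NonEmpty using (List⁺; _∷_)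
open import Data.List.Properties using (∷ʳ-injective)
open import Data.Product using (_,_)
open import Data.Sum using (inj₁; inj₂)
open import Data.Unit using (tt)
open import Relation.Binary.PropositionalEquality using (_≡_; refl; cong; trans; subst; sym)

-- A word x with x b̲ ∈ L either has a second underlined letter, or x b̲ is of the
-- first kind of L, and then the last letter b̲ forces x to be overlined with x• ⪯ b.

module _ {c ℓ : Level} (𝒦 : ωPAL c ℓ) where
  open ωPAL 𝒦
  open Words 𝒦

  countUnder-++ : ∀ x y → countUnder (x ++ y) ≡ countUnder x + countUnder y
  countUnder-++ []            y = refl
  countUnder-++ (over _ ∷ x)  y = countUnder-++ x y
  countUnder-++ (under _ ∷ x) y = cong suc (countUnder-++ x y)

  countUnder-∷ʳ-under : ∀ x b → countUnder (x ++ [ under b ]) ≡ suc (countUnder x)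
  countUnder-∷ʳ-under x b = trans (countUnder-++ x [ under b ]) (+-comm (countUnder x) 1)

  NonEmpty-++ʳ : ∀ x {y} → NonEmpty y → NonEmpty (x ++ y)
  NonEmpty-++ʳ []      ne = ne
  NonEmpty-++ʳ (_ ∷ _) _  = tt

  overWord-NonEmpty : ∀ w → NonEmpty (overWord w)
  overWord-NonEmpty (_ ∷ _) = tt

  h⇒RHS : ∀ b x → h b x → RHS b x
  h⇒RHS b x (_ , inj₁ (w , _ , x∷ʳb≡wb′ , w•⪯b′)) with ∷ʳ-injective x (overWord w) x∷ʳb≡wb′
  ... | x≡w , refl = inj₁ (w , x≡w , w•⪯b′)
  h⇒RHS b x (x-ne , inj₂ (_ , ≥2)) =
    inj₂ (x-ne , s≤s⁻¹ (subst (_≥ 2) (countUnder-∷ʳ-under x b) ≥2))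

  RHS⇒h : ∀ b x → RHS b x → h b x
  RHS⇒h b x (inj₁ (w , x≡w , w•⪯b)) =
    subst NonEmpty (sym x≡w) (overWord-NonEmpty w) ,
    inj₁ (w , b , cong (_++ [ under b ]) x≡w , w•⪯b)
  RHS⇒h b x (inj₂ (x-ne , >0)) =
    x-ne ,
    inj₂ (NonEmpty-++ʳ x tt , subst (_≥ 2) (sym (countUnder-∷ʳ-under x b)) (s≤s >0))

lemma3 : ∀ {c ℓ : Level} (𝒦 : ωPAL c ℓ) (b : ωPAL.K 𝒦) (x : Words.Word 𝒦)
         → Words.h 𝒦 b x ⇔ Words.RHS 𝒦 b x
lemma3 𝒦 b x = mk⇔ (h⇒RHS 𝒦 b x) (RHS⇒h 𝒦 b x)
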